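{- There exist constants $c_3,\dots,c_7$ such that, for all $n$ for which the respective quantities are defined (i.e. $k\leq\binom{n}{2}$), $M(3,n)\geq 3n/2-c_3$, $M(4,n)\geq 5n/3-c_4$, $M(5,n)\geq 11n/6-c_5$, $M(6,n)\geq 2n-c_6$, and $M(7,n)\geq 7n/3-c_7$.
   Context: For a finite graph $G$, $\mathrm{Mad}(G)=\max\{2e(H)/|V(H)| : H\subseteq G,\ |V(H)|\geq 1\}$ ($0$ if edgeless). $M(k,n)$ is the maximum of $\sum_{i=1}^k\mathrm{Mad}(G_i)$ over all partitions of $E(K_n)$ into $k$ spanning subgraphs $G_1,\dots,G_k$. -}

module Defs where

open import Data.Bool using (Bool; true; false; _∧_; if_then_else_)
open import Data.Nat as ℕ using (ℕ; zero; suc)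
open import Data.Fin using (Fin; toℕ)
open import Data.Fin.Properties using (_≟_)
open import Data.Product using (_×_; _,_; proj₁; proj₂)
open import Data.List using (List; []; _∷_; map; concatMap; filter; foldr; length; allFin; zip)
open import Data.Bool.ListAction using (all; any)
open import Data.Integer using (+_)
open import Data.Rational using (ℚ; 0ℚ; _⊔_; _+_; _/_)
open import Relation.Nullary.Decidable using (⌊_⌋)

sublists : {A : Set} → List A → List (List A)
sublists []       = [] ∷ []
sublists (x ∷ xs) = let r = sublists xs in map (x ∷_) r Data.List.++ r

listsOfLength : {A : Set} → ℕ → List A → List (List A)
listsOfLength zero    as = [] ∷ []
listsOfLength (suc m) as = concatMap (λ a → map (a ∷_) (listsOfLength m as)) as

maxℚ : List ℚ → ℚ
maxℚ = foldr _⊔_ 0ℚ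

-- Vertices of K_n are Fin n; an edge is a pair (i , j) with i < j.
Edge : ℕ → Set
Edge n = Fin n × Fin n

edgesK : (n : ℕ) → List (Edge n)
edgesK n = concatMap (λ i → map (λ j → (i , j))
                        (filter (λ j → toℕ i ℕ.<? toℕ j) (allFin n)))
                     (allFin n)

_∈ᵇ_ : {n : ℕ} → Fin n → List (Fin n) → Bool
v ∈ᵇ vs = any (λ w → ⌊ v ≟ w ⌋) vs

edgeEq : {n : ℕ} → Edge n → Edge n → Bool
edgeEq (a , b) (c , d) = ⌊ a ≟ c ⌋ ∧ ⌊ b ≟ d ⌋

-- A (spanning) graph on vertex set Fin n is given by its edge list E ⊆ E(K_n).
-- A subgraph H ⊆ G is a vertex set V(H) ⊆ Fin n (a sublist of allFin n)
-- together with an edge set E(H) ⊆ E(G) whose edges have both ends in V(H).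
subgraphRatios : (n : ℕ) → List (Edge n) → List ℚ
subgraphRatios n E =
  concatMap (λ V → ratios V (length V)) (sublists (allFin n))
  where
  ratios : List (Fin n) → ℕ → List ℚ
  ratios V zero    = []
  ratios V (suc s) =
    map (λ F → (+ (2 ℕ.* length F)) / suc s)
        (filter (λ F → Data.Bool._≟_ (all (λ e → (proj₁ e ∈ᵇ V) ∧ (proj₂ e ∈ᵇ V)) F) true)
                (sublists E))

Mad : (n : ℕ) → List (Edge n) → ℚ
Mad n E = maxℚ (subgraphRatios n E)

-- A colouring of E(K_n) with k colours is a list of colours, aligned with edgesK n.
-- The colour class of colour c is the spanning subgraph G_c.
colourClass : {n k : ℕ} → List (Fin k) → Fin k → List (Edge n)
colourClass {n} col c =
  map proj₁ (filter (λ p → proj₂ p ≟ c) (zip (edgesK n) col))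

-- Partition into exactly k parts: every colour is used.
surjectiveᵇ : {k : ℕ} → List (Fin k) → Bool
surjectiveᵇ {k} col = all (λ c → any (λ d → ⌊ d ≟ c ⌋) col) (allFin k)

sumℚ : List ℚ → ℚ
sumℚ = foldr _+_ 0ℚ

madSum : (k n : ℕ) → List (Fin k) → ℚ
madSum k n col = sumℚ (map (λ c → Mad n (colourClass {n} {k} col c)) (allFin k))

-- M(k,n) = max over partitions of E(K_n) into k spanning subgraphs of Σ Mad(G_i).
-- (Set to 0 when no such partition exists, i.e. k > C(n,2); only used for k ≤ C(n,2).)
M : (k n : ℕ) → ℚ
M k n = maxℚ (map (madSum k n)
                  (filter (λ col → Data.Bool._≟_ (surjectiveᵇ col) true)
                          (listsOfLength (length (edgesK n)) (allFin k))))

-- Blow up a small pattern. Give vertex v of K_n the type v mod m, so that the vertices form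
-- blocks of m consecutive vertices, and colour the edge {i < j} by a colour fixed in advance
-- for the ordered pair of types (i mod m, j mod m). If colour c is given to A_c ordered pairs
-- of types inside a set of ℓ_c types, then on the first q full blocks the colour-c edges
-- between vertices of those types number at least (q choose 2)·A_c, on q·ℓ_c vertices, so
-- Mad(G_c) ≥ (q − 1)·A_c/ℓ_c, and summing over c gives a bound linear in q ≥ n/m − 1.
-- Colouring the pairs of types by the first member of a small family of sets covering all of
-- them (for k = 7, the lines of the Fano plane) gives Σ_c A_c/ℓ_c = m·α/β, the slope α/β
-- asked for.

module Submission where

open import Data.Bool using (Bool; true; false; _∧_; T; T?)
import Data.Bool
open import Data.Bool.ListAction using (all; any)
import Data.Bool.Properties as Bool
open import Data.Fin using (Fin; toℕ; zero; suc)
open import Data.Fin.Properties using (_≟_; all?)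
open import Data.Integer as ℤ using (+_)
import Data.Integer.Properties as ℤ
import Data.Integer.Tactic.RingSolver as ℤ-Solver
open import Data.List using (List; []; _∷_; _++_; map; concatMap; filter; length; allFin; zip; tabulate; findᵇ)
import Data.List.Properties as List
open import Data.List.Membership.Propositional using (_∈_)
open import Data.List.Membership.Propositional.Properties
  using (∈-map⁺; ∈-++⁺ˡ; ∈-++⁺ʳ; ∈-concatMap⁺; ∈-filter⁺; ∈-allFin)
import Data.List.Relation.Unary.All as All
import Data.List.Relation.Unary.All.Properties as All
open import Data.List.Relation.Unary.Any as Any using (here; there)
import Data.List.Relation.Unary.Any.Properties as Any
open import Data.Maybe using (fromMaybe)
import Data.Nat
open import Data.Nat as ℕ using (ℕ; suc; zero; _+_; _*_; _≤_; _<_; _<ᵇ_; z≤n; s≤s; z<s; s<s; NonZero; _%_)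
open import Data.List.Membership.DecPropositional ℕ._≟_ using (_∈?_)
open import Data.Nat.Combinatorics using (_C_)
open import Data.Nat.DivMod using (m≡m%n+[m/n]*n; m%n<n; m<n⇒m%n≡m; [m+kn]%n≡m%n; [m+n]%n≡m%n)
open import Data.Nat.ListAction using (sum)
open import Data.Nat.ListAction.Properties using (sum-++)
open import Data.Nat.Properties hiding (_≟_)
open import Data.Nat.Tactic.RingSolver using (solve-∀)
open import Data.Product using (Σ; _×_; _,_; proj₁; proj₂)
open import Data.Rational as ℚ using (ℚ; 0ℚ; _/_; _-_; _≥_; toℚᵘ)
import Data.Rational.Properties as ℚ
open import Data.Rational.Unnormalised as ℚᵘ using (mkℚᵘ; *≤*; *≡*)
import Data.Rational.Unnormalised.Properties as ℚᵘ
open import Data.Vec using (Vec; []; _∷_; lookup)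
open import Function using (_∘_; Equivalence)
open import Level using (Level)
open import Relation.Binary.PropositionalEquality
open import Relation.Nullary using (yes; no; does)
open import Relation.Nullary.Decidable using (⌊_⌋; True; toWitness; fromWitness; dec-true; dec-false; _×-dec_)
open import Relation.Unary using (Pred; Decidable)

open import Defs

private
  toℚᵘ-/ : ∀ a d → toℚᵘ ((+ a) / suc d) ℚᵘ.≃ mkℚᵘ (+ a) d
  toℚᵘ-/ a d = ℚ.toℚᵘ-fromℚᵘ (mkℚᵘ (+ a) d)

/-≤-cross : ∀ {a b c d} → a * suc d ≤ c * suc b → (+ a) / suc b ℚ.≤ (+ c) / suc d
/-≤-cross {a} {b} {c} {d} ad≤cb = ℚ.toℚᵘ-cancel-≤
  (ℚᵘ.≤-respˡ-≃ (ℚᵘ.≃-sym (toℚᵘ-/ a b)) (ℚᵘ.≤-respʳ-≃ (ℚᵘ.≃-sym (toℚᵘ-/ c d))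
    (*≤* (subst₂ ℤ._≤_ (ℤ.pos-* a (suc d)) (ℤ.pos-* c (suc b)) (ℤ.+≤+ ad≤cb)))))

/-monoˡ-≤ : ∀ {a c} d → a ≤ c → (+ a) / suc d ℚ.≤ (+ c) / suc d
/-monoˡ-≤ {a} {c} d a≤c = /-≤-cross {a} {d} {c} {d} (*-monoˡ-≤ (suc d) a≤c)

/-distribʳ-+ : ∀ a c d → (+ (a + c)) / suc d ≡ (+ a) / suc d ℚ.+ (+ c) / suc d
/-distribʳ-+ a c d = ℚ.toℚᵘ-injective (ℚᵘ.≃-trans (toℚᵘ-/ (a + c) d)
  (ℚᵘ.≃-trans (*≡* (cross a c (suc d)))
              (ℚᵘ.≃-sym (ℚᵘ.≃-trans (ℚ.toℚᵘ-homo-+ ((+ a) / suc d) ((+ c) / suc d))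
                                    (ℚᵘ.+-cong (toℚᵘ-/ a d) (toℚᵘ-/ c d))))))
  where
  cross : ∀ a c D → + (a + c) ℤ.* + (D * D) ≡ (+ a ℤ.* + D ℤ.+ + c ℤ.* + D) ℤ.* + D
  cross a c D = trans (cong₂ ℤ._*_ (ℤ.pos-+ a c) (ℤ.pos-* D D)) (ring (+ a) (+ c) (+ D))
    where
    ring : ∀ a c D → (a ℤ.+ c) ℤ.* (D ℤ.* D) ≡ (a ℤ.* D ℤ.+ c ℤ.* D) ℤ.* D
    ring = ℤ-Solver.solve-∀

p≤q+r⇒p-r≤q : ∀ {p q r} → p ℚ.≤ q ℚ.+ r → p - r ℚ.≤ q
p≤q+r⇒p-r≤q {p} {q} {r} p≤q+r = ℚ.≤-trans (ℚ.+-monoˡ-≤ (ℚ.- r) p≤q+r) (ℚ.≤-reflexive (begin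
  q ℚ.+ r ℚ.+ ℚ.- r   ≡⟨ ℚ.+-assoc q r (ℚ.- r) ⟩
  q ℚ.+ (r ℚ.- r)     ≡⟨ cong (q ℚ.+_) (ℚ.+-inverseʳ r) ⟩
  q ℚ.+ 0ℚ            ≡⟨ ℚ.+-identityʳ q ⟩
  q                   ∎))
  where open ≡-Reasoning

module _ {α β m : ℕ} .{{_ : NonZero m}} (X : ℕ → ℚ) (X≥0 : ∀ n → 0ℚ ℚ.≤ X n)
         (X≥ : ∀ p t → 1 ≤ p → (+ (α * (p * m))) / suc β ℚ.≤ X (suc p * m + t)) where

  private
    LowerBound : ℕ → Set
    LowerBound n = X n ≥ (+ (α * n)) / suc β - (+ (α * (2 * m))) / suc β

    via : ∀ {n} y → (+ y) / suc β ℚ.≤ X n → α * n ≤ y + α * (2 * m) → LowerBound n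
    via {n} y y≤X αn≤ = p≤q+r⇒p-r≤q (begin
      (+ (α * n)) / suc β                               ≤⟨ /-monoˡ-≤ β αn≤ ⟩
      (+ (y + α * (2 * m))) / suc β                     ≡⟨ /-distribʳ-+ y _ β ⟩
      (+ y) / suc β ℚ.+ (+ (α * (2 * m))) / suc β       ≤⟨ ℚ.+-monoˡ-≤ _ y≤X ⟩
      X n ℚ.+ (+ (α * (2 * m))) / suc β                 ∎)
      where open ℚ.≤-Reasoning

    0≤X : ∀ n → (+ 0) / suc β ℚ.≤ X n
    0≤X n = subst (ℚ._≤ X n) (sym (ℚ.0/n≡0 (suc β))) (X≥0 n)

    below-next-block : ∀ q {t} → t < m → q * m + t ≤ suc q * m
    below-next-block q t<m = ≤-trans (+-monoʳ-≤ (q * m) (<⇒≤ t<m)) (≤-reflexive (+-comm (q * m) m))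

    blocks : ∀ q {t} → t < m → LowerBound (q * m + t)
    blocks zero          t<m = via 0 (0≤X _) (*-monoʳ-≤ α (≤-trans (below-next-block 0 t<m) (*-monoˡ-≤ m (s≤s (z≤n {1})))))
    blocks (suc zero)    t<m = via 0 (0≤X _) (*-monoʳ-≤ α (below-next-block 1 t<m))
    blocks (suc (suc p)) t<m = via (α * (suc p * m)) (X≥ (suc p) _ (s≤s z≤n))
      (≤-trans (*-monoʳ-≤ α (below-next-block (suc (suc p)) t<m)) (≤-reflexive (regroup α p m)))
      where
      regroup : ∀ α p m → α * (suc (suc (suc p)) * m) ≡ α * (suc p * m) + α * (2 * m)
      regroup = solve-∀

  linear-lower-bound : ∀ n → LowerBound n
  linear-lower-bound n = subst LowerBound (sym n≡) (blocks (n ℕ./ m) (m%n<n n m))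
    where
    n≡ : n ≡ n ℕ./ m * m + n % m
    n≡ = trans (m≡m%n+[m/n]*n n m) (+-comm (n % m) _)

𝟙 : Bool → ℕ
𝟙 false = 0
𝟙 true  = 1

∑< : ℕ → (ℕ → ℕ) → ℕ
∑< zero    f = 0
∑< (suc n) f = f 0 + ∑< n (f ∘ suc)

syntax ∑< n (λ i → e) = ∑[ i < n ] e

∑-cong : ∀ n {f g : ℕ → ℕ} → (∀ {i} → i < n → f i ≡ g i) → ∑< n f ≡ ∑< n g
∑-cong zero    f≡g = refl
∑-cong (suc n) f≡g = cong₂ _+_ (f≡g z<s) (∑-cong n (f≡g ∘ s<s))

∑-zero : ∀ n → ∑[ i < n ] 0 ≡ 0
∑-zero zero    = refl
∑-zero (suc n) = ∑-zero n

∑-split : ∀ a b (f : ℕ → ℕ) → ∑< (a + b) f ≡ ∑< a f + ∑[ i < b ] f (a + i)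
∑-split zero    b f = refl
∑-split (suc a) b f = trans (cong (_+_ (f 0)) (∑-split a b (f ∘ suc))) (sym (+-assoc (f 0) _ _))

∑-distrib-+ : ∀ n (f g : ℕ → ℕ) → ∑[ i < n ] (f i + g i) ≡ ∑< n f + ∑< n g
∑-distrib-+ zero    f g = refl
∑-distrib-+ (suc n) f g = trans (cong (_+_ (f 0 + g 0)) (∑-distrib-+ n (f ∘ suc) (g ∘ suc)))
                                (interchange (f 0) (g 0) _ _)
  where
  interchange : ∀ a b c d → a + b + (c + d) ≡ a + c + (b + d)
  interchange = solve-∀

∑pairs : ℕ → (ℕ → ℕ → ℕ) → ℕ
∑pairs N h = ∑[ i < N ] ∑[ j < N ] (𝟙 (i <ᵇ j) * h i j)

∑pairs-cong : ∀ N {h h′ : ℕ → ℕ → ℕ} → (∀ {i j} → i < N → j < N → h i j ≡ h′ i j) →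
              ∑pairs N h ≡ ∑pairs N h′
∑pairs-cong N h≡h′ = ∑-cong N λ {i} i<N → ∑-cong N λ {j} j<N → cong (𝟙 (i <ᵇ j) *_) (h≡h′ i<N j<N)

∑pairs-extend : ∀ N m (h : ℕ → ℕ → ℕ) → ∑pairs N h + ∑[ i < N ] ∑[ b < m ] h i (N + b) ≤ ∑pairs (N + m) h
∑pairs-extend N m h = begin
  ∑pairs N h + ∑[ i < N ] ∑[ b < m ] h i (N + b)
    ≡⟨ ∑-distrib-+ N (λ i → ∑[ j < N ] X i j) (λ i → ∑[ b < m ] h i (N + b)) ⟨
  ∑[ i < N ] (∑[ j < N ] X i j + ∑[ b < m ] h i (N + b))
    ≡⟨ ∑-cong N (λ i<N → cong (_+_ (∑[ j < N ] X _ j)) (∑-cong m (λ _ → earlier i<N))) ⟨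
  ∑[ i < N ] (∑[ j < N ] X i j + ∑[ b < m ] X i (N + b))
    ≡⟨ ∑-cong N (λ {i} _ → ∑-split N m (X i)) ⟨
  ∑[ i < N ] ∑[ j < N + m ] X i j
    ≤⟨ m≤m+n _ _ ⟩
  ∑[ i < N ] ∑[ j < N + m ] X i j + ∑[ i < m ] ∑[ j < N + m ] X (N + i) j
    ≡⟨ ∑-split N m (λ i → ∑[ j < N + m ] X i j) ⟨
  ∑pairs (N + m) h ∎
  where
  open ≤-Reasoning
  X : ℕ → ℕ → ℕ
  X i j = 𝟙 (i <ᵇ j) * h i j
  earlier : ∀ {i b} → i < N → X i (N + b) ≡ h i (N + b)
  earlier {i} {b} i<N = trans (cong (λ x → 𝟙 x * h i (N + b)) (dec-true (i ℕ.<? N + b) (<-≤-trans i<N (m≤m+n N b))))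
                              (+-identityʳ _)

module _ (m : ℕ) .{{_ : NonZero m}} where

  ∑-periodic : ∀ q (f : ℕ → ℕ) → ∑[ i < q * m ] f (i % m) ≡ q * ∑< m f
  ∑-periodic zero    f = refl
  ∑-periodic (suc q) f = begin
    ∑[ i < m + q * m ] f (i % m)
      ≡⟨ ∑-split m (q * m) (f ∘ (_% m)) ⟩
    ∑[ i < m ] f (i % m) + ∑[ i < q * m ] f ((m + i) % m)
      ≡⟨ cong₂ _+_ (∑-cong m (cong f ∘ m<n⇒m%n≡m)) (∑-cong (q * m) λ {i} _ → cong f (shift i)) ⟩
    ∑< m f + ∑[ i < q * m ] f (i % m)
      ≡⟨ cong (_+_ (∑< m f)) (∑-periodic q f) ⟩
    ∑< m f + q * ∑< m f ∎
    where
    open ≡-Reasoning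
    shift : ∀ i → (m + i) % m ≡ i % m
    shift i = trans (cong (_% m) (+-comm m i)) ([m+n]%n≡m%n i m)

  [q*m+b]%m≡b : ∀ q {b} → b < m → (q * m + b) % m ≡ b
  [q*m+b]%m≡b q {b} b<m = trans (cong (_% m) (+-comm (q * m) b)) (trans ([m+kn]%n≡m%n b q m) (m<n⇒m%n≡m b<m))

  -- The (p+2)-nd block adds, for each of the (p+1)·m earlier vertices i and each type b,
  -- the pair from i to the vertex of type b in the new block.
  ∑pairs-periodic : ∀ p (r : ℕ → ℕ → ℕ) →
    suc p * p * ∑[ a < m ] ∑[ b < m ] r a b ≤ 2 * ∑pairs (suc p * m) (λ i j → r (i % m) (j % m))
  ∑pairs-periodic zero    r = z≤n
  ∑pairs-periodic (suc p) r = begin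
    suc (suc p) * suc p * A                                 ≡⟨ regroup p A ⟩
    suc p * p * A + 2 * (suc p * A)                         ≤⟨ +-mono-≤ (∑pairs-periodic p r) (≤-reflexive (cong (2 *_) rectangle)) ⟩
    2 * ∑pairs N R + 2 * ∑[ i < N ] ∑[ b < m ] R i (N + b)   ≡⟨ *-distribˡ-+ 2 (∑pairs N R) _ ⟨
    2 * (∑pairs N R + ∑[ i < N ] ∑[ b < m ] R i (N + b))     ≤⟨ *-monoʳ-≤ 2 (∑pairs-extend N m R) ⟩
    2 * ∑pairs (N + m) R                                    ≡⟨ cong (λ x → 2 * ∑pairs x R) (+-comm N m) ⟩
    2 * ∑pairs (suc (suc p) * m) R                          ∎
    where
    open ≤-Reasoning
    A = ∑[ a < m ] ∑[ b < m ] r a b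
    N = suc p * m
    R : ℕ → ℕ → ℕ
    R i j = r (i % m) (j % m)
    regroup : ∀ p A → suc (suc p) * suc p * A ≡ suc p * p * A + 2 * (suc p * A)
    regroup = solve-∀
    rectangle : suc p * A ≡ ∑[ i < N ] ∑[ b < m ] R i (N + b)
    rectangle = sym (trans (∑-cong N λ {i} _ → ∑-cong m λ b<m → cong (r (i % m)) ([q*m+b]%m≡b (suc p) b<m))
                           (∑-periodic (suc p) (λ a → ∑[ b < m ] r a b)))

module _ {a p : Level} {A : Set a} {P : Pred A p} (P? : Decidable P) where

  sum-map-filter : ∀ (f : A → ℕ) xs → sum (map f (filter P? xs)) ≡ sum (map (λ x → 𝟙 (does (P? x)) * f x) xs)
  sum-map-filter f []       = refl
  sum-map-filter f (x ∷ xs) with does (P? x)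
  ... | true  = cong₂ _+_ (sym (+-identityʳ (f x))) (sum-map-filter f xs)
  ... | false = sum-map-filter f xs

  length-filter≡sum : ∀ xs → length (filter P? xs) ≡ sum (map (𝟙 ∘ does ∘ P?) xs)
  length-filter≡sum []       = refl
  length-filter≡sum (x ∷ xs) with does (P? x)
  ... | true  = cong suc (length-filter≡sum xs)
  ... | false = length-filter≡sum xs

sum-map-concatMap : ∀ {a b} {A : Set a} {B : Set b} (f : B → ℕ) (g : A → List B) xs →
                    sum (map f (concatMap g xs)) ≡ sum (map (λ x → sum (map f (g x))) xs)
sum-map-concatMap f g []       = refl
sum-map-concatMap f g (x ∷ xs) = begin
  sum (map f (g x ++ concatMap g xs))                         ≡⟨ cong sum (List.map-++ f (g x) _) ⟩
  sum (map f (g x) ++ map f (concatMap g xs))                 ≡⟨ sum-++ (map f (g x)) _ ⟩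
  sum (map f (g x)) + sum (map f (concatMap g xs))            ≡⟨ cong (_+_ (sum (map f (g x)))) (sum-map-concatMap f g xs) ⟩
  sum (map f (g x)) + sum (map (λ x → sum (map f (g x))) xs)  ∎
  where open ≡-Reasoning

sum-map-*ˡ : ∀ {A : Set} p (f : A → ℕ) xs → sum (map (λ x → p * f x) xs) ≡ p * sum (map f xs)
sum-map-*ˡ p f []       = sym (*-zeroʳ p)
sum-map-*ˡ p f (x ∷ xs) = trans (cong (_+_ (p * f x)) (sum-map-*ˡ p f xs)) (sym (*-distribˡ-+ p (f x) _))

sum-map-allFin : ∀ n (f : ℕ → ℕ) → sum (map (f ∘ toℕ) (allFin n)) ≡ ∑< n f
sum-map-allFin n f = trans (cong sum (List.map-tabulate {n = n} (λ i → i) (f ∘ toℕ))) (sum-tabulate n f)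
  where
  sum-tabulate : ∀ n (f : ℕ → ℕ) → sum (tabulate {n = n} (f ∘ toℕ)) ≡ ∑< n f
  sum-tabulate zero    f = refl
  sum-tabulate (suc n) f = cong (_+_ (f 0)) (sum-tabulate n (f ∘ suc))

sum-map-edgesK : ∀ n (g : ℕ → ℕ → ℕ) →
                 sum (map (λ e → g (toℕ (proj₁ e)) (toℕ (proj₂ e))) (edgesK n)) ≡ ∑pairs n g
sum-map-edgesK n g = begin
  sum (map g′ (edgesK n))
    ≡⟨ sum-map-concatMap g′ (λ i → map (i ,_) (filter (later i) (allFin n))) (allFin n) ⟩
  sum (map (λ i → sum (map g′ (map (i ,_) (filter (later i) (allFin n))))) (allFin n))
    ≡⟨ cong sum (List.map-cong row (allFin n)) ⟩
  sum (map (λ i → ∑[ j < n ] (𝟙 (toℕ i <ᵇ j) * g (toℕ i) j)) (allFin n))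
    ≡⟨ sum-map-allFin n (λ i → ∑[ j < n ] (𝟙 (i <ᵇ j) * g i j)) ⟩
  ∑pairs n g ∎
  where
  open ≡-Reasoning
  g′ : Edge n → ℕ
  g′ e = g (toℕ (proj₁ e)) (toℕ (proj₂ e))
  later : (i : Fin n) → Decidable (λ j → toℕ i < toℕ j)
  later i j = toℕ i ℕ.<? toℕ j
  row : ∀ i → sum (map g′ (map (i ,_) (filter (later i) (allFin n)))) ≡ ∑[ j < n ] (𝟙 (toℕ i <ᵇ j) * g (toℕ i) j)
  row i = begin
    sum (map g′ (map (i ,_) (filter (later i) (allFin n))))              ≡⟨ cong sum (List.map-∘ (filter (later i) (allFin n))) ⟨
    sum (map (λ j → g (toℕ i) (toℕ j)) (filter (later i) (allFin n)))     ≡⟨ sum-map-filter (later i) _ (allFin n) ⟩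
    sum (map (λ j → 𝟙 (toℕ i <ᵇ toℕ j) * g (toℕ i) (toℕ j)) (allFin n))  ≡⟨ sum-map-allFin n (λ j → 𝟙 (toℕ i <ᵇ j) * g (toℕ i) j) ⟩
    ∑[ j < n ] (𝟙 (toℕ i <ᵇ j) * g (toℕ i) j)                             ∎

sumℚ-map-mono : ∀ {A : Set} {f g : A → ℚ} → (∀ x → f x ℚ.≤ g x) → ∀ xs → sumℚ (map f xs) ℚ.≤ sumℚ (map g xs)
sumℚ-map-mono f≤g []       = ℚ.≤-refl
sumℚ-map-mono f≤g (x ∷ xs) = ℚ.+-mono-≤ (f≤g x) (sumℚ-map-mono f≤g xs)

sumℚ-map-/ : ∀ {A : Set} (f : A → ℕ) d xs → sumℚ (map (λ x → (+ f x) / suc d) xs) ≡ (+ sum (map f xs)) / suc d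
sumℚ-map-/ f d []       = sym (ℚ.0/n≡0 (suc d))
sumℚ-map-/ f d (x ∷ xs) = trans (cong ((+ f x) / suc d ℚ.+_) (sumℚ-map-/ f d xs)) (sym (/-distribʳ-+ (f x) _ d))

filter∈sublists : ∀ {p} {A : Set} {P : Pred A p} (P? : Decidable P) xs → filter P? xs ∈ sublists xs
filter∈sublists P? []       = here refl
filter∈sublists P? (x ∷ xs) with does (P? x)
... | true  = ∈-++⁺ˡ (∈-map⁺ (x ∷_) (filter∈sublists P? xs))
... | false = ∈-++⁺ʳ (map (x ∷_) (sublists xs)) (filter∈sublists P? xs)

∈⇒≤maxℚ : ∀ {x} xs → x ∈ xs → x ℚ.≤ maxℚ xs
∈⇒≤maxℚ (y ∷ ys) (here refl)  = ℚ.p≤p⊔q y (maxℚ ys)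
∈⇒≤maxℚ (y ∷ ys) (there x∈ys) = ℚ.≤-trans (∈⇒≤maxℚ ys x∈ys) (ℚ.p≤q⊔p y (maxℚ ys))

0≤maxℚ : ∀ xs → 0ℚ ℚ.≤ maxℚ xs
0≤maxℚ []       = ℚ.≤-refl
0≤maxℚ (y ∷ ys) = ℚ.≤-trans (0≤maxℚ ys) (ℚ.p≤q⊔p y (maxℚ ys))

∈⇒∈ᵇ : ∀ {n} {v : Fin n} {vs} → v ∈ vs → T (v ∈ᵇ vs)
∈⇒∈ᵇ {v = v} = Any.any⁺ (λ w → ⌊ v ≟ w ⌋) ∘ Any.map (λ { refl → fromWitness refl })

joins : ∀ {n} → List (Fin n) → Edge n → Bool
joins V e = (proj₁ e ∈ᵇ V) ∧ (proj₂ e ∈ᵇ V)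

Mad-≥-subgraph : ∀ {n E V F a d} → V ∈ sublists (allFin n) → F ∈ sublists E → all (joins V) F ≡ true →
                 1 ≤ length F → a * length V ≤ 2 * length F * suc d → (+ a) / suc d ℚ.≤ Mad n E
Mad-≥-subgraph {V = []} {F = []}    _ _ _  () _
Mad-≥-subgraph {V = []} {F = _ ∷ _} _ _ () _  _
Mad-≥-subgraph {n} {E} {v ∷ V} {F} {a} {d} V∈ F∈ joined _ a|V|≤2|F|d =
  ℚ.≤-trans (/-≤-cross {a} {d} {2 * length F} {length V} a|V|≤2|F|d) (∈⇒≤maxℚ (subgraphRatios n E) ratio∈)
  where
  ratio∈ : (+ (2 * length F)) / suc (length V) ∈ subgraphRatios n E
  ratio∈ = ∈-concatMap⁺ _ (Any.map (λ { refl → ∈-map⁺ _ (∈-filter⁺ (λ F → Data.Bool._≟_ _ true) F∈ joined) }) V∈)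

listsOfLength-complete : ∀ {k} (xs : List (Fin k)) → xs ∈ listsOfLength (length xs) (allFin k)
listsOfLength-complete []       = here refl
listsOfLength-complete (x ∷ xs) =
  ∈-concatMap⁺ _ (Any.map (λ { refl → ∈-map⁺ (x ∷_) (listsOfLength-complete xs) }) (∈-allFin x))

M-≥-madSum : ∀ {k n} (col : List (Fin k)) → length col ≡ length (edgesK n) → surjectiveᵇ col ≡ true →
             madSum k n col ℚ.≤ M k n
M-≥-madSum {k} {n} col |col|≡|E| surjective = ∈⇒≤maxℚ _ (∈-map⁺ (madSum k n)
  (∈-filter⁺ (λ col → Data.Bool._≟_ (surjectiveᵇ col) true)
             (subst (λ l → col ∈ listsOfLength l (allFin k)) |col|≡|E| (listsOfLength-complete col)) surjective))

0≤M : ∀ k n → 0ℚ ℚ.≤ M k n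
0≤M k n = 0≤maxℚ (map (madSum k n) (filter (λ col → Data.Bool._≟_ (surjectiveᵇ col) true)
                                                (listsOfLength (length (edgesK n)) (allFin k))))

module _ {A : Set} {k : ℕ} (κ : A → Fin k) (c : Fin k) where

  colourClass-map : ∀ xs → map proj₁ (filter (λ p → proj₂ p ≟ c) (zip xs (map κ xs))) ≡ filter (λ x → κ x ≟ c) xs
  colourClass-map []       = refl
  colourClass-map (x ∷ xs) with κ x ≟ c
  ... | yes _ = cong (x ∷_) (colourClass-map xs)
  ... | no  _ = colourClass-map xs

  colour-used : ∀ xs → 1 ≤ length (filter (λ x → κ x ≟ c) xs) → any (λ d → ⌊ d ≟ c ⌋) (map κ xs) ≡ true
  colour-used (x ∷ xs) used with κ x ≟ c
  ... | yes _ = refl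
  ... | no  _ = colour-used xs used

all-true : ∀ {A : Set} {p : A → Bool} → (∀ x → p x ≡ true) → ∀ xs → all p xs ≡ true
all-true p≡true []       = refl
all-true p≡true (x ∷ xs) rewrite p≡true x = all-true p≡true xs

1≤2*n⇒1≤n : ∀ {n} → 1 ≤ 2 * n → 1 ≤ n
1≤2*n⇒1≤n {suc n} _ = s≤s z≤n

module BlowUp {k : ℕ} (m : ℕ) .{{_ : NonZero m}} (colour : ℕ → ℕ → Fin k) (support : Fin k → ℕ → Bool) where

  edgeColour : ∀ n → Edge n → Fin k
  edgeColour n e = colour (toℕ (proj₁ e) % m) (toℕ (proj₂ e) % m)

  blowUp : ∀ n → List (Fin k)
  blowUp n = map (edgeColour n) (edgesK n)

  supportSize : Fin k → ℕ
  supportSize c = ∑[ a < m ] 𝟙 (support c a)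

  colouredPair : Fin k → ℕ → ℕ → ℕ
  colouredPair c a b = 𝟙 (does (colour a b ≟ c)) * 𝟙 (support c a ∧ support c b)

  colouredPairs : Fin k → ℕ
  colouredPairs c = ∑[ a < m ] ∑[ b < m ] colouredPair c a b

  module Colour (p t : ℕ) (c : Fin k) where

    N = suc p * m
    n = N + t

    inBlocks : ℕ → Bool
    inBlocks v = (v <ᵇ N) ∧ support c (v % m)

    inBlocks-< : ∀ {v} → v < N → inBlocks v ≡ support c (v % m)
    inBlocks-< {v} v<N = cong (_∧ support c (v % m)) (dec-true (v ℕ.<? N) v<N)

    edgeInBlocks : Edge n → Bool
    edgeInBlocks e = inBlocks (toℕ (proj₁ e)) ∧ inBlocks (toℕ (proj₂ e))

    V : List (Fin n)
    V = filter (T? ∘ inBlocks ∘ toℕ) (allFin n)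

    class : List (Edge n)
    class = colourClass (blowUp n) c

    F : List (Edge n)
    F = filter (T? ∘ edgeInBlocks) class

    class≡ : class ≡ filter (λ e → edgeColour n e ≟ c) (edgesK n)
    class≡ = colourClass-map (edgeColour n) c (edgesK n)

    |V|≡ : length V ≡ suc p * supportSize c
    |V|≡ = begin
      length V
        ≡⟨ length-filter≡sum (T? ∘ inBlocks ∘ toℕ) (allFin n) ⟩
      sum (map (𝟙 ∘ inBlocks ∘ toℕ) (allFin n))
        ≡⟨ sum-map-allFin n (𝟙 ∘ inBlocks) ⟩
      ∑[ v < N + t ] 𝟙 (inBlocks v)
        ≡⟨ ∑-split N t (𝟙 ∘ inBlocks) ⟩
      ∑[ v < N ] 𝟙 (inBlocks v) + ∑[ v < t ] 𝟙 (inBlocks (N + v))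
        ≡⟨ cong₂ _+_ (∑-cong N (cong 𝟙 ∘ inBlocks-<)) (∑-cong t (λ _ → beyond)) ⟩
      ∑[ v < N ] 𝟙 (support c (v % m)) + ∑[ v < t ] 0
        ≡⟨ cong₂ _+_ (∑-periodic m (suc p) (𝟙 ∘ support c)) (∑-zero t) ⟩
      suc p * supportSize c + 0
        ≡⟨ +-identityʳ _ ⟩
      suc p * supportSize c ∎
      where
      open ≡-Reasoning
      beyond : ∀ {v} → 𝟙 (inBlocks (N + v)) ≡ 0
      beyond {v} = cong (λ b → 𝟙 (b ∧ support c ((N + v) % m))) (dec-false ((N + v) ℕ.<? N) (m+n≮m N v))

    2|F|≥ : suc p * p * colouredPairs c ≤ 2 * length F
    2|F|≥ = begin
      suc p * p * colouredPairs c                             ≤⟨ ∑pairs-periodic m p (colouredPair c) ⟩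
      2 * ∑pairs N (λ i j → colouredPair c (i % m) (j % m))   ≡⟨ cong (2 *_) (∑pairs-cong N in-blocks) ⟨
      2 * ∑pairs N g                                          ≤⟨ *-monoʳ-≤ 2 (≤-trans (m≤m+n (∑pairs N g) _) (∑pairs-extend N t g)) ⟩
      2 * ∑pairs n g                                          ≡⟨ cong (2 *_) count ⟨
      2 * length F                                            ∎
      where
      open ≤-Reasoning
      g : ℕ → ℕ → ℕ
      g i j = 𝟙 (does (colour (i % m) (j % m) ≟ c)) * 𝟙 (inBlocks i ∧ inBlocks j)
      in-blocks : ∀ {i j} → i < N → j < N → g i j ≡ colouredPair c (i % m) (j % m)
      in-blocks {i} {j} i<N j<N =
        cong (λ b → 𝟙 (does (colour (i % m) (j % m) ≟ c)) * 𝟙 b) (cong₂ _∧_ (inBlocks-< i<N) (inBlocks-< j<N))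
      count : length F ≡ ∑pairs n g
      count = begin-equality
        length F
          ≡⟨ length-filter≡sum (T? ∘ edgeInBlocks) class ⟩
        sum (map (𝟙 ∘ edgeInBlocks) class)
          ≡⟨ cong (sum ∘ map (𝟙 ∘ edgeInBlocks)) class≡ ⟩
        sum (map (𝟙 ∘ edgeInBlocks) (filter (λ e → edgeColour n e ≟ c) (edgesK n)))
          ≡⟨ sum-map-filter (λ e → edgeColour n e ≟ c) (𝟙 ∘ edgeInBlocks) (edgesK n) ⟩
        sum (map (λ e → g (toℕ (proj₁ e)) (toℕ (proj₂ e))) (edgesK n))
          ≡⟨ sum-map-edgesK n g ⟩
        ∑pairs n g ∎

    F-nonempty : 1 ≤ p → 1 ≤ colouredPairs c → 1 ≤ length F
    F-nonempty 1≤p 1≤A = 1≤2*n⇒1≤n (≤-trans (*-mono-≤ (*-mono-≤ (s≤s (z≤n {p})) 1≤p) 1≤A) 2|F|≥)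

    c-used : 1 ≤ p → 1 ≤ colouredPairs c → any (λ d → ⌊ d ≟ c ⌋) (blowUp n) ≡ true
    c-used 1≤p 1≤A = colour-used (edgeColour n) c (edgesK n)
      (≤-trans (F-nonempty 1≤p 1≤A)
               (≤-trans (List.length-filter (T? ∘ edgeInBlocks) class) (≤-reflexive (cong length class≡))))

    Mad-≥-share : ∀ {β s} → 1 ≤ p → 1 ≤ colouredPairs c → s * supportSize c ≤ suc β * colouredPairs c →
                  (+ (p * s)) / suc β ℚ.≤ Mad n class
    Mad-≥-share {β} {s} 1≤p 1≤A sℓ≤βA =
      Mad-≥-subgraph {a = p * s} {d = β} (filter∈sublists _ (allFin n)) (filter∈sublists _ class) joined
                     (F-nonempty 1≤p 1≤A) cross
      where
      ℓ = supportSize c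
      A = colouredPairs c
      endpoints : ∀ {e} → T (edgeInBlocks e) → T (joins V e)
      endpoints {i , j} i,j∈ = let i∈ , j∈ = Equivalence.to Bool.T-∧ i,j∈ in
        Equivalence.from Bool.T-∧ (∈⇒∈ᵇ (∈-filter⁺ (T? ∘ inBlocks ∘ toℕ) (∈-allFin i) i∈) ,
                                   ∈⇒∈ᵇ (∈-filter⁺ (T? ∘ inBlocks ∘ toℕ) (∈-allFin j) j∈))
      joined : all (joins V) F ≡ true
      joined = Equivalence.to Bool.T-≡ (All.all⁻ (joins V) (All.map endpoints (All.all-filter (T? ∘ edgeInBlocks) class)))
      cross : p * s * length V ≤ 2 * length F * suc β
      cross = begin
        p * s * length V          ≡⟨ cong (p * s *_) |V|≡ ⟩
        p * s * (suc p * ℓ)       ≡⟨ regroup₁ p s ℓ ⟩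
        suc p * p * (s * ℓ)       ≤⟨ *-monoʳ-≤ (suc p * p) sℓ≤βA ⟩
        suc p * p * (suc β * A)   ≡⟨ regroup₂ (suc p * p) (suc β) A ⟩
        suc p * p * A * suc β     ≤⟨ *-monoˡ-≤ (suc β) 2|F|≥ ⟩
        2 * length F * suc β      ∎
        where
        open ≤-Reasoning
        regroup₁ : ∀ p s ℓ → p * s * (suc p * ℓ) ≡ suc p * p * (s * ℓ)
        regroup₁ = solve-∀
        regroup₂ : ∀ x b A → x * (b * A) ≡ x * A * b
        regroup₂ = solve-∀

  -- share c / (β + 1) is the part of the slope α·m / (β + 1) contributed by colour c.
  M-≥-blowUp : ∀ α β (share : Fin k → ℕ) →
               (∀ c → 1 ≤ colouredPairs c × share c * supportSize c ≤ suc β * colouredPairs c) →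
               α * m ≤ sum (map share (allFin k)) →
               ∀ p t → 1 ≤ p → (+ (α * (p * m))) / suc β ℚ.≤ M k (suc p * m + t)
  M-≥-blowUp α β share certified slope p t 1≤p = begin
    (+ (α * (p * m))) / suc β                                 ≤⟨ /-monoˡ-≤ β total ⟩
    (+ sum (map (λ c → p * share c) (allFin k))) / suc β      ≡⟨ sumℚ-map-/ (λ c → p * share c) β (allFin k) ⟨
    sumℚ (map (λ c → (+ (p * share c)) / suc β) (allFin k))  ≤⟨ sumℚ-map-mono per-colour (allFin k) ⟩
    madSum k n (blowUp n)                                     ≤⟨ M-≥-madSum {n = n} (blowUp n) (List.length-map _ (edgesK n)) surjective ⟩
    M k n                                                     ∎
    where
    open ℚ.≤-Reasoning
    n = suc p * m + t
    total : α * (p * m) ≤ sum (map (λ c → p * share c) (allFin k))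
    total = ≤-trans (≤-reflexive (swap α p m))
              (≤-trans (*-monoʳ-≤ p slope) (≤-reflexive (sym (sum-map-*ˡ p share (allFin k)))))
      where
      swap : ∀ α p m → α * (p * m) ≡ p * (α * m)
      swap = solve-∀
    per-colour : ∀ c → (+ (p * share c)) / suc β ℚ.≤ Mad n (colourClass (blowUp n) c)
    per-colour c = Colour.Mad-≥-share p t c 1≤p (proj₁ (certified c)) (proj₂ (certified c))
    surjective : surjectiveᵇ (blowUp n) ≡ true
    surjective = all-true (λ c → Colour.c-used p t c 1≤p (proj₁ (certified c))) (allFin k)

module CoverPattern {k : ℕ} (m : ℕ) .{{_ : NonZero m}} (cover : Vec (List ℕ) (suc k)) where

  covers : Fin (suc k) → ℕ → Bool
  covers c a = ⌊ a ∈? lookup cover c ⌋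

  firstCover : ℕ → ℕ → Fin (suc k)
  firstCover a b = fromMaybe zero (findᵇ (λ c → covers c a ∧ covers c b) (allFin (suc k)))

  open BlowUp m firstCover covers

  M-≥-linear : ∀ α β (share : Vec ℕ (suc k)) →
    {_ : True (all? λ c → 1 ℕ.≤? colouredPairs c ×-dec lookup share c * supportSize c ℕ.≤? suc β * colouredPairs c)} →
    {_ : True (α * m ℕ.≤? sum (map (lookup share) (allFin (suc k))))} →
    ∀ n → M (suc k) n ≥ (+ (α * n)) / suc β - (+ (α * (2 * m))) / suc β
  M-≥-linear α β share {certified} {slope} = linear-lower-bound {α} {β} (M (suc k)) (0≤M (suc k))
    (M-≥-blowUp α β (lookup share) (toWitness certified) (toWitness slope))

cover₃ : Vec (List ℕ) 3
cover₃ = (0 ∷ []) ∷ (1 ∷ []) ∷ (0 ∷ 1 ∷ []) ∷ []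

cover₄ : Vec (List ℕ) 4
cover₄ = (0 ∷ 1 ∷ []) ∷ (2 ∷ []) ∷ (0 ∷ 2 ∷ []) ∷ (1 ∷ 2 ∷ []) ∷ []

cover₅ : Vec (List ℕ) 5
cover₅ = (0 ∷ 1 ∷ []) ∷ (2 ∷ 3 ∷ []) ∷ (0 ∷ 2 ∷ 3 ∷ []) ∷ (1 ∷ 2 ∷ []) ∷ (1 ∷ 3 ∷ []) ∷ []

cover₆ : Vec (List ℕ) 6
cover₆ = (0 ∷ []) ∷ (1 ∷ []) ∷ (2 ∷ []) ∷ (0 ∷ 1 ∷ []) ∷ (0 ∷ 2 ∷ []) ∷ (1 ∷ 2 ∷ []) ∷ []

fano-lines : Vec (List ℕ) 7
fano-lines = (0 ∷ 1 ∷ 2 ∷ []) ∷ (0 ∷ 3 ∷ 4 ∷ []) ∷ (0 ∷ 5 ∷ 6 ∷ []) ∷ (1 ∷ 3 ∷ 5 ∷ [])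
           ∷ (1 ∷ 4 ∷ 6 ∷ []) ∷ (2 ∷ 3 ∷ 6 ∷ []) ∷ (2 ∷ 4 ∷ 5 ∷ []) ∷ []

open CoverPattern using (M-≥-linear)

proposition4p2 : Σ ℚ λ c₃ → Σ ℚ λ c₄ → Σ ℚ λ c₅ → Σ ℚ λ c₆ → Σ ℚ λ c₇ →
      ((n : ℕ) → 3 ≤ n C 2 → M 3 n ≥ ((+ (3 Data.Nat.* n)) / 2) - c₃)
    × ((n : ℕ) → 4 ≤ n C 2 → M 4 n ≥ ((+ (5 Data.Nat.* n)) / 3) - c₄)
    × ((n : ℕ) → 5 ≤ n C 2 → M 5 n ≥ ((+ (11 Data.Nat.* n)) / 6) - c₅)
    × ((n : ℕ) → 6 ≤ n C 2 → M 6 n ≥ ((+ (2 Data.Nat.* n)) / 1) - c₆)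
    × ((n : ℕ) → 7 ≤ n C 2 → M 7 n ≥ ((+ (7 Data.Nat.* n)) / 3) - c₇)
proposition4p2 = (+ 12) / 2 , (+ 30) / 3 , (+ 88) / 6 , (+ 12) / 1 , (+ 98) / 3 ,
    (λ n _ → M-≥-linear 2 cover₃     3  1 (2 ∷ 2 ∷ 2 ∷ []) n)
  , (λ n _ → M-≥-linear 3 cover₄     5  2 (6 ∷ 3 ∷ 3 ∷ 3 ∷ []) n)
  , (λ n _ → M-≥-linear 4 cover₅     11 5 (12 ∷ 12 ∷ 8 ∷ 6 ∷ 6 ∷ []) n)
  , (λ n _ → M-≥-linear 3 cover₆     2  0 (1 ∷ 1 ∷ 1 ∷ 1 ∷ 1 ∷ 1 ∷ []) n)
  , (λ n _ → M-≥-linear 7 fano-lines 7  2 (9 ∷ 8 ∷ 8 ∷ 6 ∷ 6 ∷ 6 ∷ 6 ∷ []) n)
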